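{- Let $\mathcal{G}$ be a temporal graph whose underlying graph is a tree. Suppose a root $r$ can be chosen such that, for every vertex $v$, the edges incident to $v$ are active strictly before all other edges in the subtree rooted at $v$. Then $\mathcal{G}$ has a TIM decomposition of width $\max_t\max_v\deg_{G'_t}(v)+1$, where $G'_t$ is the snapshot at time $t$ of the temporal graph $\mathcal{G}'$ obtained from $\mathcal{G}$ by adding the time-edge $(uv,t)$ for all vertices $u,v$ and times $t$ for which there exist times $t_1<t<t_2$ with $(uv,t_1)$ and $(uv,t_2)$ time-edges of $\mathcal{G}$.
   Context: A temporal graph $\mathcal{G}=(G,\lambda)$: static (underlying) graph $G=(V,E)$ and $\lambda:E\to 2^{\mathbb{N}}$; time-edges $(e,t)$ with $t\in\lambda(e)$; an edge is active at times $\lambda(e)$; snapshot $G_t=(V,\{e:t\in\lambda(e)\})$; lifetime $\Lambda=\max_e\max\lambda(e)$. TIM decomposition: triple $(T,B,\tau)$, $T$ a directed tree, bags $B(s)\subseteq V$, $\tau$ assigning each bag a time in $[\Lambda]$, such that (1) each vertex $v$ and time $t\in[\Lambda]$ lies in exactly one bag labelled $t$; (2) each time-edge $(uv,t)$ has a unique node $i$ with $\{u,v\}\subseteq B(i)$, $\tau(B(i))=t$; (3) arcs of $T$ are exactly the pairs $(i,j)$ with $B(i)\cap B(j)\neq\emptyset$ and $\tau(B(j))=\tau(B(i))+1$. Width is the maximum bag size. -}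

module Defs where

open import Data.Nat using (ℕ; zero; suc; _≤_; _<_; _⊔_; _≤ᵇ_; _<ᵇ_)
open import Data.Fin using (Fin)
open import Data.Fin.Subset using (Subset; ∣_∣) renaming (_∈_ to _∈ₛ_)
open import Data.Bool using (Bool; true; false; _∧_; _∨_)
open import Data.List using (List; []; _∷_; _∷ʳ_; length; head; last; map; foldr; upTo; allFin)
open import Data.Bool.ListAction using (any)
open import Data.List.Relation.Unary.Linked using (Linked)
open import Data.List.Relation.Unary.Unique.Propositional using (Unique)
open import Data.List.Membership.Propositional using (_∈_)
open import Data.Maybe using (just)
open import Data.Vec using (tabulate)
open import Data.Product using (Σ; _×_; ∃; ∃-syntax)
open import Relation.Binary.PropositionalEquality using (_≡_; _≢_)
open import Relation.Binary.Construct.Closure.ReflexiveTransitive using (Star)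
open import Relation.Nullary using (¬_)
open import Data.Sum using (_⊎_)

HasCycle : {k : ℕ} → (Fin k → Fin k → Set) → Set
HasCycle {k} Adj =
  Σ (Fin k) λ x → Σ (List (Fin k)) λ xs →
    (2 ≤ length xs) × Unique (x ∷ xs) × Linked Adj ((x ∷ xs) ∷ʳ x)

Connected : {k : ℕ} → (Fin k → Fin k → Set) → Set
Connected Adj = ∀ u v → Star Adj u v

IsTree : {k : ℕ} → (Fin k → Fin k → Set) → Set
IsTree Adj = Connected Adj × ¬ HasCycle Adj

-- w lies in the subtree rooted at v (tree rooted at r):
-- v lies on the (unique) simple path from r to w
InSubtree : {k : ℕ} → (Fin k → Fin k → Set) → Fin k → Fin k → Fin k → Set
InSubtree {k} Adj r v w =
  (xs : List (Fin k)) → Linked Adj xs → Unique xs →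
  head xs ≡ just r → last xs ≡ just w → v ∈ xs

-- Temporal graphs.  Vertices Fin n, times are positive naturals,
-- act u v t = true  iff  (uv, t) is a time-edge.  Λ is the lifetime
-- (the maximum time of a time-edge; 0 if there is none).

record TemporalGraph : Set where
  field
    n      : ℕ
    Λ      : ℕ
    act    : Fin n → Fin n → ℕ → Bool
    act-sym    : ∀ u v t → act u v t ≡ act v u t
    act-irrefl : ∀ v t → act v v t ≡ false
    act-range  : ∀ u v t → act u v t ≡ true → (1 ≤ t) × (t ≤ Λ)
    Λ-attained : Λ ≢ 0 → ∃[ u ] ∃[ v ] (act u v Λ ≡ true)

open TemporalGraph public

UAdj : (𝒢 : TemporalGraph) → Fin (n 𝒢) → Fin (n 𝒢) → Set
UAdj 𝒢 u v = ∃[ t ] (act 𝒢 u v t ≡ true)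

times : TemporalGraph → List ℕ
times 𝒢 = upTo (suc (Λ 𝒢))

act' : (𝒢 : TemporalGraph) → Fin (n 𝒢) → Fin (n 𝒢) → ℕ → Bool
act' 𝒢 u v t =
  act 𝒢 u v t ∨
  (any (λ t₁ → (t₁ <ᵇ t) ∧ act 𝒢 u v t₁) (times 𝒢) ∧
   any (λ t₂ → (t <ᵇ t₂) ∧ act 𝒢 u v t₂) (times 𝒢))

deg' : (𝒢 : TemporalGraph) → ℕ → Fin (n 𝒢) → ℕ
deg' 𝒢 t v = ∣ tabulate (λ u → act' 𝒢 u v t) ∣

maximum : List ℕ → ℕ
maximum = foldr _⊔_ 0

-- max_t max_v deg_{G'_t}(v)   (G'_t has no edges outside times 1..Λ)
maxDeg' : TemporalGraph → ℕ
maxDeg' 𝒢 = maximum (map (λ t → maximum (map (deg' 𝒢 t) (allFin (n 𝒢)))) (times 𝒢))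

∃! : {A : Set} → (A → Set) → Set
∃! {A} P = Σ A λ x → P x × (∀ y → P y → y ≡ x)

record TIMDecomposition (𝒢 : TemporalGraph) : Set₁ where
  field
    m   : ℕ                          -- nodes of T are Fin m
    B   : Fin m → Subset (n 𝒢)
    τ   : Fin m → ℕ
    τ-range : ∀ i → (1 ≤ τ i) × (τ i ≤ Λ 𝒢)
    cover-vertex : ∀ v t → 1 ≤ t → t ≤ Λ 𝒢 →
                   ∃! λ i → (τ i ≡ t) × (v ∈ₛ B i)
    cover-edge   : ∀ u v t → act 𝒢 u v t ≡ true →
                   ∃! λ i → (u ∈ₛ B i) × (v ∈ₛ B i) × (τ i ≡ t)

  -- (3) the arcs of T are exactly these pairs
  Arc : Fin m → Fin m → Set
  Arc i j = (∃[ v ] (v ∈ₛ B i × v ∈ₛ B j)) × (τ j ≡ suc (τ i))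

  ArcU : Fin m → Fin m → Set
  ArcU i j = Arc i j ⊎ Arc j i

  field
    -- T is a directed tree (its underlying undirected graph is a tree)
    T-tree : IsTree ArcU

HasWidthAtMost : {𝒢 : TemporalGraph} → TIMDecomposition 𝒢 → ℕ → Set
HasWidthAtMost D w = ∀ i → ∣ TIMDecomposition.B D i ∣ ≤ w

RootOrdered : (𝒢 : TemporalGraph) → Fin (n 𝒢) → Set
RootOrdered 𝒢 r =
  ∀ v b x y t₁ t₂ →
  act 𝒢 v b t₁ ≡ true →
  InSubtree (UAdj 𝒢) r v x → InSubtree (UAdj 𝒢) r v y →
  ¬ (x ≡ v) → ¬ (y ≡ v) →
  act 𝒢 x y t₂ ≡ true →
  t₁ < t₂

-- Root the tree at r.  At time t every vertex v either joins the bag of its parent, when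
-- the edge v — parent v is present in G'_t, or heads a bag of its own; so the bag headed by
-- o at time t consists of o and some of its G'_t-neighbours, and each time-edge lies in the
-- bag headed by its upper endpoint.  This is well defined thanks to the root ordering: the
-- parent edges of v and of parent v are never both present in G'_t.  In the tree T, each
-- bag other than the one of r at time 1 is joined to the bag of its head one time step
-- earlier if the parent edge of the head has already appeared, and one step later
-- otherwise.  These steps strictly decrease the potential (depth of the head, time still to
-- travel), and every arc of T is such a step, so T is connected and acyclic.
module Submission where

open import Defs
open import Data.Bool using (Bool; true; false; T; _∧_; _∨_; if_then_else_) renaming (_≟_ to _≟ᵇ_)
open import Data.Bool.Properties using (T-∨; T-∧; T-≡; ¬-not)
open import Data.Bool.ListAction using (any)
open import Data.Empty using (⊥; ⊥-elim)
open import Data.Fin as Fin using (Fin) renaming (_≟_ to _≟ᶠ_)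
open import Data.Fin.Properties using (any?)
import Data.Fin.Properties as FinP
open import Data.Fin.Subset using (Subset; ∣_∣; inside; outside) renaming (_∈_ to _∈ₛ_)
open import Data.Fin.Subset.Properties using (∣p∣≤∣x∷p∣; p⊆q⇒∣p∣≤∣q∣; drop-there)
open import Data.List using (List; []; _∷_; _∷ʳ_; length; last; lookup; filter; map; allFin; cartesianProduct)
open import Data.List.Membership.Propositional using (_∈_; _∉_; lose)
open import Data.List.Membership.Propositional.Properties
  using (∈-upTo⁺; ∈-filter⁺; ∈-filter⁻; ∈-lookup; ∈-map⁺; ∈-allFin; ∈-cartesianProduct⁺)
open import Data.List.Relation.Unary.All as All using (All; []; _∷_)
open import Data.List.Relation.Unary.All.Properties using (∷ʳ⁺)
open import Data.List.Relation.Unary.AllPairs using ([]; _∷_)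
import Data.List.Relation.Unary.AllPairs.Properties as AllPairs
open import Data.List.Relation.Unary.Any as Any using (here; there; satisfied)
open import Data.List.Relation.Unary.Any.Properties using (any⁺; any⁻; lookup-index)
open import Data.List.Relation.Unary.Linked as Linked using (Linked; []; [-]; _∷_)
import Data.List.Relation.Unary.Linked.Properties as Linked
open import Data.List.Relation.Unary.Unique.Propositional using (Unique)
import Data.List.Relation.Unary.Unique.Propositional.Properties as Unique
open import Data.Maybe using (just)
import Data.Maybe.Relation.Binary.Connected as Maybe
open import Data.Nat using (ℕ; zero; suc; pred; _+_; _*_; _∸_; _≤_; _<_; z≤n; s≤s; s≤s⁻¹; _<ᵇ_; _≤?_; >-nonZero)
open import Data.Nat.Induction using (<-wellFounded)
open import Data.Nat.Properties
open import Data.Product as Prod using (∃; ∃-syntax; _×_; _,_; proj₁; proj₂)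
open import Data.Sum as Sum using (_⊎_; inj₁; inj₂)
open import Data.Unit using (⊤; tt)
open import Data.Vec using (tabulate; _∷_)
import Data.Vec as Vec
open import Data.Vec.Properties using (lookup∘tabulate; []=⇒lookup; lookup⇒[]=)
open import Function using (_∘_)
open import Function.Bundles using (_⇔_; mk⇔; Equivalence)
import Induction.WellFounded as WF
open import Relation.Binary.Construct.Closure.ReflexiveTransitive as Star using (Star; ε; _◅_; _◅◅_)
open import Relation.Binary.Definitions using (tri<; tri≈; tri>)
open import Relation.Binary.PropositionalEquality
open import Relation.Nullary using (¬_; Dec; yes; no; does; contradiction)
open import Relation.Nullary.Decidable using (map′; dec-true; toSum; _⊎-dec_; _×-dec_)
open import Relation.Unary using (Pred; Decidable)

pred[n]<n : ∀ {t} → 1 ≤ t → pred t < t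
pred[n]<n (s≤s z≤n) = ≤-refl

≤-maximum : ∀ {x} xs → x ∈ xs → x ≤ maximum xs
≤-maximum (y ∷ ys) (here refl) = m≤m⊔n y (maximum ys)
≤-maximum (y ∷ ys) (there x∈ys) = ≤-trans (≤-maximum ys x∈ys) (m≤n⊔m y (maximum ys))

private
  ∣x∷p∣≤1+∣p∣ : ∀ {k} b (p : Subset k) → ∣ b ∷ p ∣ ≤ suc ∣ p ∣
  ∣x∷p∣≤1+∣p∣ inside p = ≤-refl
  ∣x∷p∣≤1+∣p∣ outside p = n≤1+n ∣ p ∣

  ∈-tail : ∀ {k b c x} {p q : Subset k} → (∀ {y} → y ∈ₛ b ∷ p → y ≢ x → y ∈ₛ c ∷ q) →
           ∀ {y} → y ∈ₛ p → Fin.suc y ≢ x → y ∈ₛ q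
  ∈-tail p-x⊆q y∈p 1+y≢x = drop-there (p-x⊆q (Vec.there y∈p) 1+y≢x)

∣p∣≤1+∣q∣ : ∀ {k} {p q : Subset k} x → (∀ {y} → y ∈ₛ p → y ≢ x → y ∈ₛ q) → ∣ p ∣ ≤ suc ∣ q ∣
∣p∣≤1+∣q∣ {p = b ∷ p} {c ∷ q} Fin.zero p-x⊆q =
  ≤-trans (∣x∷p∣≤1+∣p∣ b p) (s≤s (≤-trans (p⊆q⇒∣p∣≤∣q∣ (λ y∈p → ∈-tail p-x⊆q y∈p λ ())) (∣p∣≤∣x∷p∣ c q)))
∣p∣≤1+∣q∣ {p = inside ∷ p} {inside ∷ q} (Fin.suc x) p-x⊆q =
  s≤s (∣p∣≤1+∣q∣ x (λ y∈p y≢x → ∈-tail p-x⊆q y∈p (y≢x ∘ FinP.suc-injective)))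
∣p∣≤1+∣q∣ {p = inside ∷ p} {outside ∷ q} (Fin.suc x) p-x⊆q with p-x⊆q Vec.here (λ ())
... | ()
∣p∣≤1+∣q∣ {p = outside ∷ p} {c ∷ q} (Fin.suc x) p-x⊆q =
  ≤-trans (∣p∣≤1+∣q∣ x (λ y∈p y≢x → ∈-tail p-x⊆q y∈p (y≢x ∘ FinP.suc-injective))) (s≤s (∣p∣≤∣x∷p∣ c q))

∈-tabulate : ∀ {k} (f : Fin k → Bool) {v} → v ∈ₛ tabulate f ⇔ f v ≡ true
∈-tabulate f {v} = mk⇔ (λ v∈ → trans (sym (lookup∘tabulate f v)) ([]=⇒lookup v∈))
                       (λ fv → lookup⇒[]= v _ (trans (lookup∘tabulate f v) fv))

∈-tabulate-does : ∀ {k} {P : Fin k → Set} (P? : ∀ v → Dec (P v)) {v} → v ∈ₛ tabulate (λ u → does (P? u)) ⇔ P v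
∈-tabulate-does P? {v} = mk⇔ (λ v∈ → witness (P? v) (Equivalence.to (∈-tabulate _) v∈))
                             (λ Pv → Equivalence.from (∈-tabulate _) (dec-true (P? v) Pv))
  where
  witness : ∀ {A : Set} (A? : Dec A) → does A? ≡ true → A
  witness (yes a) _ = a

last-∷ʳ : ∀ {A : Set} (xs : List A) y → last (xs ∷ʳ y) ≡ just y
last-∷ʳ [] y = refl
last-∷ʳ (x ∷ []) y = refl
last-∷ʳ (x ∷ x′ ∷ xs) y = last-∷ʳ (x′ ∷ xs) y

linked-∷ʳ : ∀ {A : Set} {R : A → A → Set} {x b c} {xs} →
            Linked R (x ∷ xs) → last (x ∷ xs) ≡ just b → R b c → Linked R (x ∷ xs ∷ʳ c)
linked-∷ʳ {R = R} {c = c} walk ends Rbc =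
  Linked.++⁺ walk (subst (λ m → Maybe.Connected R m (just c)) (sym ends) (Maybe.just Rbc)) [-]

unique-∷ʳ : ∀ {A : Set} {xs : List A} {c} → Unique xs → All (_≢ c) xs → Unique (xs ∷ʳ c)
unique-∷ʳ u c∉ = AllPairs.++⁺ u ([] ∷ []) (All.map (_∷ []) c∉)

lookup-injective : ∀ {A : Set} {xs : List A} → Unique xs → ∀ i j → lookup xs i ≡ lookup xs j → i ≡ j
lookup-injective {xs = _ ∷ _} _ Fin.zero Fin.zero _ = refl
lookup-injective {xs = _ ∷ _} (x∉ ∷ _) Fin.zero (Fin.suc j) x≡ = contradiction x≡ (All.lookup x∉ (∈-lookup j))
lookup-injective {xs = _ ∷ _} (x∉ ∷ _) (Fin.suc i) Fin.zero ≡x = contradiction (sym ≡x) (All.lookup x∉ (∈-lookup i))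
lookup-injective {xs = _ ∷ _} (_ ∷ u) (Fin.suc i) (Fin.suc j) eq = cong Fin.suc (lookup-injective u i j eq)

module _ {p} {P : Pred ℕ p} (P? : Decidable P) where

  leastWitness : ∀ n → P n → ∃[ i ] (P i × ∀ {j} → j < i → ¬ P j)
  leastWitness = WF.All.wfRec <-wellFounded _ _ step
    where
    step : ∀ n → (∀ {m} → m < n → P m → ∃[ i ] (P i × ∀ {j} → j < i → ¬ P j)) →
           P n → ∃[ i ] (P i × ∀ {j} → j < i → ¬ P j)
    step n smaller Pn with anyUpTo? P? n
    ... | yes (m , m<n , Pm) = smaller m<n Pm
    ... | no none = n , Pn , λ j<n Pj → none (_ , j<n , Pj)

module Enumeration {A : Set} {P : A → Set} (P? : ∀ x → Dec (P x)) (xs : List A) (xs-unique : Unique xs) where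

  size : ℕ
  size = length (filter P? xs)

  element : Fin size → A
  element = lookup (filter P? xs)

  element-satisfies : ∀ i → P (element i)
  element-satisfies i = proj₂ (∈-filter⁻ P? {xs = xs} (∈-lookup i))

  index : ∀ {x} → x ∈ xs → P x → Fin size
  index x∈ Px = Any.index (∈-filter⁺ P? x∈ Px)

  element-index : ∀ {x} (x∈ : x ∈ xs) (Px : P x) → element (index x∈ Px) ≡ x
  element-index x∈ Px = sym (lookup-index (∈-filter⁺ P? x∈ Px))

  element-injective : ∀ i j → element i ≡ element j → i ≡ j
  element-injective = lookup-injective (Unique.filter⁺ P? xs-unique)

module Descent {k : ℕ} {Adj S : Fin k → Fin k → Set}
               (S-functional : ∀ {a b c} → S a b → S a c → b ≡ c)
               (Φ : Fin k → ℕ) (S-descends : ∀ {a b} → S a b → Φ b < Φ a)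
               (Adj⇒S : ∀ {a b} → Adj a b → S a b ⊎ S b a) where

  NonBacktracking : List (Fin k) → Set
  NonBacktracking (a ∷ b ∷ c ∷ l) = a ≢ c × NonBacktracking (b ∷ c ∷ l)
  NonBacktracking _ = ⊤

  data EndsWith : List (Fin k) → Fin k → Fin k → Set where
    end : ∀ p q → EndsWith (p ∷ q ∷ []) p q
    _∷_ : ∀ {l p q} a → EndsWith l p q → EndsWith (a ∷ l) p q

  -- Once a non-backtracking walk goes against S, functionality of S keeps it doing so.
  backward-run : ∀ {a b l p q} → Linked Adj (a ∷ b ∷ l) → NonBacktracking (a ∷ b ∷ l) →
                 S b a → EndsWith (a ∷ b ∷ l) p q → S q p × Φ a < Φ q
  backward-run {l = []} _ _ Sba (end _ _) = Sba , S-descends Sba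
  backward-run {l = []} _ _ _ (_ ∷ (_ ∷ ()))
  backward-run {l = c ∷ l} (_ ∷ walk) (a≢c , nb) Sba (_ ∷ ends) with Adj⇒S (Linked.head walk)
  ... | inj₁ Sbc = contradiction (S-functional Sba Sbc) a≢c
  ... | inj₂ Scb = Prod.map₂ (<-trans (S-descends Sba)) (backward-run walk nb Scb ends)

  forward-run : ∀ {a b l p q} → Linked Adj (a ∷ b ∷ l) → NonBacktracking (a ∷ b ∷ l) →
                S a b → EndsWith (a ∷ b ∷ l) p q → Φ q < Φ a ⊎ S q p
  forward-run {l = []} _ _ Sab (end _ _) = inj₁ (S-descends Sab)
  forward-run {l = []} _ _ _ (_ ∷ (_ ∷ ()))
  forward-run {l = c ∷ l} (_ ∷ walk) (_ , nb) Sab (_ ∷ ends) with Adj⇒S (Linked.head walk)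
  ... | inj₁ Sbc = Sum.map₁ (λ Φq<Φb → <-trans Φq<Φb (S-descends Sab)) (forward-run walk nb Sbc ends)
  ... | inj₂ Scb = inj₂ (proj₁ (backward-run walk nb Scb ends))

  nonBacktracking-∷ʳ : ∀ {x} xs → Unique xs → x ∉ xs → NonBacktracking (xs ∷ʳ x)
  nonBacktracking-∷ʳ [] _ _ = tt
  nonBacktracking-∷ʳ (a ∷ []) _ _ = tt
  nonBacktracking-∷ʳ (a ∷ b ∷ []) _ x∉ = (λ a≡x → x∉ (here (sym a≡x))) , tt
  nonBacktracking-∷ʳ (a ∷ b ∷ c ∷ l) ((_ ∷ a≢c ∷ _) ∷ u) x∉ =
    a≢c , nonBacktracking-∷ʳ (b ∷ c ∷ l) u (x∉ ∘ there)

  endsWith-∷ʳ : ∀ a b l x → ∃[ w ] (EndsWith ((a ∷ b ∷ l) ∷ʳ x) w x × w ∈ b ∷ l)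
  endsWith-∷ʳ a b [] x = b , a ∷ end b x , here refl
  endsWith-∷ʳ a b (c ∷ l) x with endsWith-∷ʳ b c l x
  ... | w , ends , w∈ = w , a ∷ ends , there w∈

  cycle-nonBacktracking : ∀ {x y z} zs → Unique (x ∷ y ∷ z ∷ zs) → NonBacktracking ((x ∷ y ∷ z ∷ zs) ∷ʳ x)
  cycle-nonBacktracking zs u@(x∉ ∷ u′) =
    All.lookup x∉ (there (here refl)) , nonBacktracking-∷ʳ (_ ∷ _ ∷ zs) u′ (Unique.Unique[x∷xs]⇒x∉xs u)

  -- On a cycle x y … w x: if x — y goes against S, so does every later edge and Φ grows
  -- strictly around the cycle; if it goes along S, then either all edges do and Φ
  -- shrinks strictly, or the last one goes against S, i.e. S x w, and functionality
  -- forces w = y.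
  acyclic : ¬ HasCycle Adj
  acyclic (x , [] , () , _)
  acyclic (x , _ ∷ [] , s≤s () , _)
  acyclic (x , y ∷ z ∷ zs , _ , u@(_ ∷ y∉ ∷ _) , cycle)
    with endsWith-∷ʳ y z zs x | Adj⇒S (Linked.head cycle)
  ... | _ , ends , _ | inj₂ Syx =
    <-irrefl refl (proj₂ (backward-run cycle (cycle-nonBacktracking zs u) Syx (x ∷ ends)))
  ... | _ , ends , w∈ | inj₁ Sxy with forward-run cycle (cycle-nonBacktracking zs u) Sxy (x ∷ ends)
  ...   | inj₁ Φx<Φx = <-irrefl refl Φx<Φx
  ...   | inj₂ Sxw = All.lookup y∉ w∈ (S-functional Sxy Sxw)

  module _ (Adj-sym : ∀ {a b} → Adj a b → Adj b a) (S⇒Adj : ∀ {a b} → S a b → Adj a b) where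

    toSink : ∀ ρ → (∀ i → i ≢ ρ → ∃ (S i)) → ∀ n i → Φ i < n → Star Adj i ρ
    toSink ρ step (suc n) i Φi<1+n with i ≟ᶠ ρ
    ... | yes refl = ε
    ... | no i≢ρ with step i i≢ρ
    ...   | j , Sij = S⇒Adj Sij ◅ toSink ρ step n j (≤-trans (S-descends Sij) (s≤s⁻¹ Φi<1+n))

    -- The sink need only exist once some node is given: the graph may be empty.
    connected : (Fin k → ∃[ ρ ] (∀ i → i ≢ ρ → ∃ (S i))) → Connected Adj
    connected sink i j with sink i
    ... | ρ , step = toSink ρ step _ i ≤-refl ◅◅ Star.reverse Adj-sym (toSink ρ step _ j ≤-refl)

module RootedTree {k : ℕ} {Adj : Fin k → Fin k → Set} (Adj? : ∀ u v → Dec (Adj u v))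
                  (Adj-sym : ∀ {u v} → Adj u v → Adj v u) (Adj-irrefl : ∀ {v} → ¬ Adj v v)
                  (tree : IsTree Adj) (r : Fin k) where

  Near : ℕ → Fin k → Set
  Near zero w = w ≡ r
  Near (suc j) w = Near j w ⊎ ∃[ u ] (Near j u × Adj u w)

  near? : ∀ j w → Dec (Near j w)
  near? zero w = w ≟ᶠ r
  near? (suc j) w = near? j w ⊎-dec any? (λ u → near? j u ×-dec Adj? u w)

  near-◅◅ : ∀ {j x w} → Near j x → Star Adj x w → ∃[ i ] Near i w
  near-◅◅ near ε = _ , near
  near-◅◅ near (Axy ◅ walk) = near-◅◅ (inj₂ (_ , near , Axy)) walk

  -- Abstract, so that type checking never unfolds the searches behind depth and parent.
  abstract
    depthWitness : ∀ w → ∃[ i ] (Near i w × ∀ {j} → j < i → ¬ Near j w)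
    depthWitness w = leastWitness (λ j → near? j w) _ (proj₂ (near-◅◅ refl (proj₁ tree r w)))

    depth : Fin k → ℕ
    depth w = proj₁ (depthWitness w)

    near-depth : ∀ w → Near (depth w) w
    near-depth w = proj₁ (proj₂ (depthWitness w))

    depth-minimal : ∀ {j w} → Near j w → depth w ≤ j
    depth-minimal {w = w} near = ≮⇒≥ λ j<d → proj₂ (proj₂ (depthWitness w)) j<d near

  depth-r : depth r ≡ 0
  depth-r = n≤0⇒n≡0 (depth-minimal refl)

  depth≡0⇒≡r : ∀ {w} → depth w ≡ 0 → w ≡ r
  depth≡0⇒≡r {w} d≡0 = subst (λ j → Near j w) d≡0 (near-depth w)

  depth≡suc⇒≢r : ∀ {j w} → depth w ≡ suc j → w ≢ r
  depth≡suc⇒≢r d≡1+j refl = 0≢1+n (trans (sym depth-r) d≡1+j)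

  depth-adj : ∀ {u w} → Adj u w → depth w ≤ suc (depth u)
  depth-adj {u} Auw = depth-minimal (inj₂ (u , near-depth u , Auw))

  hasParent : ∀ {w} → w ≢ r → ∃[ u ] (Adj u w × suc (depth u) ≡ depth w)
  hasParent {w} w≢r with depth w in d≡ | near-depth w
  ... | zero | w≡r = contradiction w≡r w≢r
  ... | suc j | inj₁ near = contradiction (subst (_≤ j) d≡ (depth-minimal near)) (n≮n j)
  ... | suc j | inj₂ (u , near-u , Auw) =
    u , Auw , cong suc (≤-antisym (depth-minimal near-u) (s≤s⁻¹ (subst (_≤ suc (depth u)) d≡ (depth-adj Auw))))

  abstract
    parent : Fin k → Fin k
    parent w with any? (λ u → Adj? u w ×-dec (suc (depth u) ≟ depth w))
    ... | yes (u , _) = u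
    ... | no _ = r

    parent-spec : ∀ {w} → w ≢ r → Adj (parent w) w × suc (depth (parent w)) ≡ depth w
    parent-spec {w} w≢r with any? (λ u → Adj? u w ×-dec (suc (depth u) ≟ depth w))
    ... | yes (_ , spec) = spec
    ... | no none = contradiction (hasParent w≢r) none

    parent-r : parent r ≡ r
    parent-r with any? (λ u → Adj? u r ×-dec (suc (depth u) ≟ depth r))
    ... | yes (_ , _ , 1+du≡dr) = contradiction (trans 1+du≡dr depth-r) 1+n≢0
    ... | no _ = refl

  parent-adj : ∀ {w} → w ≢ r → Adj (parent w) w
  parent-adj w≢r = proj₁ (parent-spec w≢r)

  depth-parent : ∀ {w} → w ≢ r → suc (depth (parent w)) ≡ depth w
  depth-parent w≢r = proj₂ (parent-spec w≢r)

  depth-parent< : ∀ {w} → w ≢ r → depth (parent w) < depth w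
  depth-parent< w≢r = ≤-reflexive (depth-parent w≢r)

  record Path (j : ℕ) (a b : Fin k) : Set where
    constructor path
    field
      tail   : List (Fin k)
      linked : Linked Adj (a ∷ tail)
      unique : Unique (a ∷ tail)
      ends   : last (a ∷ tail) ≡ just b
      low    : All (λ v → depth v ≤ j) (a ∷ tail)

  deeper-∉ : ∀ {j c vs} → j < depth c → All (λ v → depth v ≤ j) vs → All (_≢ c) vs
  deeper-∉ j<dc = All.map λ dv≤j v≡c → <⇒≱ j<dc (subst (λ v → depth v ≤ _) v≡c dv≤j)

  lift : ∀ {j a b} → Path j a b → Path (suc j) a b
  lift (path tail walk u ends low) = path tail walk u ends (All.map m≤n⇒m≤1+n low)

  prepend : ∀ {j a b c} → Adj c a → suc j ≡ depth c → Path j a b → Path (suc j) c b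
  prepend Aca dc (path tail walk u ends low) =
    path (_ ∷ tail) (Aca ∷ walk) (All.map ≢-sym (deeper-∉ (≤-reflexive dc) low) ∷ u) ends
         (≤-reflexive (sym dc) ∷ All.map m≤n⇒m≤1+n low)

  extend : ∀ {j a b c} (P : Path j a b) → Adj b c → depth c ≤ j → All (_≢ c) (a ∷ Path.tail P) → Path j a c
  extend (path tail walk u ends low) Abc dc c∉ =
    path (tail ∷ʳ _) (linked-∷ʳ walk ends Abc) (unique-∷ʳ u c∉) (last-∷ʳ (_ ∷ tail) _) (∷ʳ⁺ low dc)

  depth-parent≡ : ∀ {j w} → w ≢ r → depth w ≡ suc j → depth (parent w) ≡ j
  depth-parent≡ w≢r dw = suc-injective (trans (depth-parent w≢r) dw)

  -- Climb from both ends to the common ancestor.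
  levelPath : ∀ j {x y} → depth x ≡ j → depth y ≡ j → Path j x y
  levelPath j {x} {y} dx dy with x ≟ᶠ y
  ... | yes refl = path [] [-] ([] ∷ []) refl (≤-reflexive dx ∷ [])
  levelPath zero dx dy | no x≢y = contradiction (trans (depth≡0⇒≡r dx) (sym (depth≡0⇒≡r dy))) x≢y
  levelPath (suc j) {x} {y} dx dy | no x≢y =
    extend (prepend (Adj-sym (parent-adj x≢r)) (sym dx) Q) (parent-adj y≢r) (≤-reflexive dy)
           (x≢y ∷ deeper-∉ (≤-reflexive (sym dy)) (Path.low Q))
    where
    x≢r : x ≢ r
    x≢r = depth≡suc⇒≢r dx
    y≢r : y ≢ r
    y≢r = depth≡suc⇒≢r dy
    Q : Path j (parent x) (parent y)
    Q = levelPath j (depth-parent≡ x≢r dx) (depth-parent≡ y≢r dy)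

  no-shortcut : ∀ {j a b x} (P : Path j a b) → All (x ≢_) (a ∷ Path.tail P) → a ≢ b → Adj x a → Adj b x → ⊥
  no-shortcut (path [] _ _ refl _) _ a≢a _ _ = a≢a refl
  no-shortcut {x = x} (path (v ∷ tail) walk u ends _) x∉ _ Axa Abx =
    proj₂ tree (x , _ ∷ v ∷ tail , s≤s (s≤s z≤n) , x∉ ∷ u , Axa ∷ linked-∷ʳ walk ends Abx)

  parent-of-deeper : ∀ {u w} → Adj u w → depth w ≡ suc (depth u) → parent w ≡ u
  parent-of-deeper {u} {w} Auw dw with parent w ≟ᶠ u
  ... | yes pw≡u = pw≡u
  ... | no pw≢u =
    ⊥-elim (no-shortcut P (All.map ≢-sym (deeper-∉ (≤-reflexive (sym dw)) (Path.low P))) pw≢u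
                       (Adj-sym (parent-adj w≢r)) Auw)
    where
    w≢r : w ≢ r
    w≢r = depth≡suc⇒≢r dw
    P : Path (depth u) (parent w) u
    P = levelPath (depth u) (depth-parent≡ w≢r dw) refl

  level-nonadjacent : ∀ {u w} → Adj u w → depth u ≢ depth w
  level-nonadjacent {u} {w} Auw du≡dw with depth u in du
  ... | zero = Adj-irrefl (subst (λ v → Adj v w) (trans (depth≡0⇒≡r du) (sym (depth≡0⇒≡r (sym du≡dw)))) Auw)
  ... | suc j = no-shortcut P u∉P pu≢w (Adj-sym (parent-adj u≢r)) (Adj-sym Auw)
    where
    dw : depth w ≡ suc j
    dw = sym du≡dw
    u≢r : u ≢ r
    u≢r = depth≡suc⇒≢r du
    w≢r : w ≢ r
    w≢r = depth≡suc⇒≢r dw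
    Q : Path j (parent u) (parent w)
    Q = levelPath j (depth-parent≡ u≢r du) (depth-parent≡ w≢r dw)
    P : Path (suc j) (parent u) w
    P = extend (lift Q) (parent-adj w≢r) (≤-reflexive dw) (deeper-∉ (≤-reflexive (sym dw)) (Path.low Q))
    u∉P : All (u ≢_) (parent u ∷ Path.tail P)
    u∉P = ∷ʳ⁺ (All.map ≢-sym (deeper-∉ (≤-reflexive (sym du)) (Path.low Q)))
              (λ { refl → Adj-irrefl Auw })
    pu≢w : parent u ≢ w
    pu≢w pu≡w = 1+n≢n (trans (sym dw) (trans (sym (cong depth pu≡w)) (depth-parent≡ u≢r du)))

  adj⇒parent : ∀ {u w} → Adj u w → parent w ≡ u ⊎ parent u ≡ w
  adj⇒parent {u} {w} Auw with <-cmp (depth u) (depth w)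
  ... | tri< du<dw _ _ = inj₁ (parent-of-deeper Auw (≤-antisym (depth-adj Auw) du<dw))
  ... | tri≈ _ du≡dw _ = contradiction du≡dw (level-nonadjacent Auw)
  ... | tri> _ _ dw<du = inj₂ (parent-of-deeper (Adj-sym Auw) (≤-antisym (depth-adj (Adj-sym Auw)) dw<du))

  data Ancestor (a : Fin k) : Fin k → Set where
    self      : Ancestor a a
    viaParent : ∀ {w} → w ≢ r → Ancestor a (parent w) → Ancestor a w

  ancestor-of-r : ∀ {a} → Ancestor a r → a ≡ r
  ancestor-of-r self = refl
  ancestor-of-r (viaParent r≢r _) = contradiction refl r≢r

  descending : ∀ {p x} xs → parent x ≡ p → All (p ≢_) xs → Linked Adj (x ∷ xs) → Unique (x ∷ xs) →
               Linked (λ a b → parent b ≡ a) (x ∷ xs)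
  descending [] _ _ _ _ = [-]
  descending (y ∷ ys) px≡p (p≢y ∷ _) (Axy ∷ walk) ((_ ∷ x∉ys) ∷ u) with adj⇒parent Axy
  ... | inj₁ py≡x = py≡x ∷ descending ys py≡x x∉ys walk u
  ... | inj₂ px≡y = contradiction (trans (sym px≡p) px≡y) p≢y

  ancestor∈descending : ∀ {a x w} xs → Linked (λ a b → parent b ≡ a) (x ∷ xs) → last (x ∷ xs) ≡ just w →
                        Ancestor a w → a ∈ x ∷ xs ⊎ Ancestor a (parent x)
  ancestor∈descending [] _ refl self = inj₁ (here refl)
  ancestor∈descending [] _ refl (viaParent _ a≼pw) = inj₂ a≼pw
  ancestor∈descending {a} (y ∷ ys) (py≡x ∷ chain) ends a≼w with ancestor∈descending ys chain ends a≼w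
  ... | inj₁ a∈ = inj₁ (there a∈)
  ... | inj₂ a≼py with subst (Ancestor a) py≡x a≼py
  ...   | self = inj₁ (here refl)
  ...   | viaParent _ a≼px = inj₂ a≼px

  ancestor⇒inSubtree : ∀ {a w} → Ancestor a w → InSubtree Adj r a w
  ancestor⇒inSubtree a≼w [] _ _ () _
  ancestor⇒inSubtree {a} a≼w (_ ∷ xs) walk u@(r∉xs ∷ _) refl ends
    with ancestor∈descending xs (descending xs parent-r r∉xs walk u) ends a≼w
  ... | inj₁ a∈ = a∈
  ... | inj₂ a≼pr = here (ancestor-of-r (subst (Ancestor a) parent-r a≼pr))

module Properties (𝒢 : TemporalGraph) where

  V : Set
  V = Fin (n 𝒢)

  ActiveBy : V → V → ℕ → Set
  ActiveBy u v t = ∃[ t₁ ] (t₁ ≤ t × act 𝒢 u v t₁ ≡ true)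

  ActiveFrom : V → V → ℕ → Set
  ActiveFrom u v t = ∃[ t₂ ] (t ≤ t₂ × act 𝒢 u v t₂ ≡ true)

  activeBy? : ∀ u v t → Dec (ActiveBy u v t)
  activeBy? u v t = map′ (λ { (t₁ , t₁<1+t , a) → t₁ , s≤s⁻¹ t₁<1+t , a })
                         (λ { (t₁ , t₁≤t , a) → t₁ , s≤s t₁≤t , a })
                         (anyUpTo? (λ s → act 𝒢 u v s ≟ᵇ true) (suc t))

  uadj? : ∀ u v → Dec (UAdj 𝒢 u v)
  uadj? u v = map′ (λ { (t , _ , a) → t , a })
                   (λ { (t , a) → t , proj₂ (act-range 𝒢 u v t a) , a })
                   (activeBy? u v (Λ 𝒢))

  act-swap : ∀ {u v t} → act 𝒢 u v t ≡ true → act 𝒢 v u t ≡ true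
  act-swap {u} {v} {t} a = trans (sym (act-sym 𝒢 u v t)) a

  uadj-sym : ∀ {u v} → UAdj 𝒢 u v → UAdj 𝒢 v u
  uadj-sym (t , a) = t , act-swap a

  uadj-irrefl : ∀ {v} → ¬ UAdj 𝒢 v v
  uadj-irrefl {v} (t , a) = contradiction (trans (sym a) (act-irrefl 𝒢 v t)) λ ()

  private
    earlier⁻ : ∀ {s s′ b} → T ((s <ᵇ s′) ∧ b) → s < s′ × b ≡ true
    earlier⁻ {s} {s′} T-s<s′∧b with Equivalence.to T-∧ T-s<s′∧b
    ... | T-s<s′ , T-b = <ᵇ⇒< s s′ T-s<s′ , Equivalence.to T-≡ T-b

    earlier⁺ : ∀ {s s′ b} → s < s′ → b ≡ true → T ((s <ᵇ s′) ∧ b)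
    earlier⁺ s<s′ refl = Equivalence.from T-∧ (<⇒<ᵇ s<s′ , _)

    inTimes : ∀ {u v t} → act 𝒢 u v t ≡ true → t ∈ times 𝒢
    inTimes {u} {v} {t} a = ∈-upTo⁺ (s≤s (proj₂ (act-range 𝒢 u v t a)))

    earlierAct laterAct : V → V → ℕ → ℕ → Bool
    earlierAct u v t s = (s <ᵇ t) ∧ act 𝒢 u v s
    laterAct u v t s = (t <ᵇ s) ∧ act 𝒢 u v s

    between : V → V → ℕ → Bool
    between u v t = any (earlierAct u v t) (times 𝒢) ∧ any (laterAct u v t) (times 𝒢)

  act'⇒straddle : ∀ {u v t} → act' 𝒢 u v t ≡ true → ActiveBy u v t × ActiveFrom u v t
  act'⇒straddle {u} {v} {t} act'≡true with act 𝒢 u v t in a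
  ... | true = (t , ≤-refl , a) , (t , ≤-refl , a)
  ... | false
    with Equivalence.to (T-∧ {any (earlierAct u v t) (times 𝒢)} {any (laterAct u v t) (times 𝒢)})
                        (Equivalence.from T-≡ act'≡true)
  ...   | T-before , T-after
    with satisfied (any⁻ (earlierAct u v t) (times 𝒢) T-before) | satisfied (any⁻ (laterAct u v t) (times 𝒢) T-after)
  ...     | t₁ , T₁ | t₂ , T₂ with earlier⁻ T₁ | earlier⁻ T₂
  ...       | t₁<t , a₁ | t<t₂ , a₂ = (t₁ , <⇒≤ t₁<t , a₁) , (t₂ , <⇒≤ t<t₂ , a₂)

  straddle⇒act' : ∀ {u v t} → ActiveBy u v t → ActiveFrom u v t → act' 𝒢 u v t ≡ true
  straddle⇒act' {u} {v} (t₁ , t₁≤t , a₁) (t₂ , t≤t₂ , a₂) with m≤n⇒m<n∨m≡n t₁≤t | m≤n⇒m<n∨m≡n t≤t₂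
  ... | inj₂ refl | _ = cong (_∨ between u v t₁) a₁
  ... | inj₁ _ | inj₂ refl = cong (_∨ between u v t₂) a₂
  straddle⇒act' {u} {v} {t} (t₁ , _ , a₁) (t₂ , _ , a₂) | inj₁ t₁<t | inj₁ t<t₂ =
    Equivalence.to T-≡ (Equivalence.from (T-∨ {act 𝒢 u v t}) (inj₂ (Equivalence.from T-∧
      (any⁺ (earlierAct u v t) (lose (inTimes a₁) (earlier⁺ t₁<t a₁)) ,
       any⁺ (laterAct u v t) (lose (inTimes a₂) (earlier⁺ t<t₂ a₂))))))

  act⇒act' : ∀ {u v t} → act 𝒢 u v t ≡ true → act' 𝒢 u v t ≡ true
  act⇒act' {u} {v} {t} a = cong (_∨ between u v t) a

  act'-sym : ∀ {u v t} → act' 𝒢 u v t ≡ true → act' 𝒢 v u t ≡ true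
  act'-sym act'≡true with act'⇒straddle act'≡true
  ... | (t₁ , t₁≤t , a₁) , (t₂ , t≤t₂ , a₂) = straddle⇒act' (t₁ , t₁≤t , act-swap a₁) (t₂ , t≤t₂ , act-swap a₂)

  act'-irrefl : ∀ {v t} → ¬ act' 𝒢 v v t ≡ true
  act'-irrefl act'≡true with act'⇒straddle act'≡true
  ... | (t₁ , _ , a₁) , _ = uadj-irrefl (t₁ , a₁)

  deg'≤maxDeg' : ∀ {t} v → t ≤ Λ 𝒢 → deg' 𝒢 t v ≤ maxDeg' 𝒢
  deg'≤maxDeg' {t} v t≤Λ =
    ≤-trans (≤-maximum _ (∈-map⁺ (deg' 𝒢 t) (∈-allFin v)))
            (≤-maximum _ (∈-map⁺ (λ s → maximum (map (deg' 𝒢 s) (allFin (n 𝒢)))) (∈-upTo⁺ (s≤s t≤Λ))))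

module Construction (𝒢 : TemporalGraph) (tree : IsTree (UAdj 𝒢)) (r : Fin (n 𝒢))
                    (root-ordered : RootOrdered 𝒢 r) where

  open Properties 𝒢
  open RootedTree uadj? uadj-sym uadj-irrefl tree r

  joinsParent : V → ℕ → Bool
  joinsParent v t = act' 𝒢 (parent v) v t

  joinsParent⇒≢r : ∀ {v t} → joinsParent v t ≡ true → v ≢ r
  joinsParent⇒≢r {t = t} joins refl = act'-irrefl (subst (λ p → act' 𝒢 p r t ≡ true) parent-r joins)

  -- The edge v — parent v is active by time t and the edge parent v — parent (parent v)
  -- from time t on, whereas the root ordering at parent (parent v) puts the latter first.
  joinsParent-exclusive : ∀ {v t} → joinsParent v t ≡ true → joinsParent (parent v) t ≡ false
  joinsParent-exclusive {v} {t} joins with joinsParent (parent v) t in joins′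
  ... | false = refl
  ... | true with act'⇒straddle joins | act'⇒straddle joins′
  ...   | (t₁ , t₁≤t , a₁) , _ | _ , (t₂ , t≤t₂ , a₂) =
    contradiction (≤-trans t₁≤t t≤t₂)
      (<⇒≱ (root-ordered g p p v t₂ t₁ a₂ (ancestor⇒inSubtree g≼p) (ancestor⇒inSubtree g≼v) p≢g v≢g a₁))
    where
    p g : V
    p = parent v
    g = parent p
    v≢r : v ≢ r
    v≢r = joinsParent⇒≢r joins
    p≢r : p ≢ r
    p≢r = joinsParent⇒≢r joins′
    g≼p : Ancestor g p
    g≼p = viaParent p≢r self
    g≼v : Ancestor g v
    g≼v = viaParent v≢r g≼p
    p≢g : p ≢ g
    p≢g p≡g = <-irrefl (cong depth (sym p≡g)) (depth-parent< p≢r)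
    v≢g : v ≢ g
    v≢g v≡g = <-irrefl (cong depth (sym v≡g)) (<-trans (depth-parent< p≢r) (depth-parent< v≢r))

  abstract
    host : V → ℕ → V
    host v t = if joinsParent v t then parent v else v

    host-joined : ∀ {v t} → joinsParent v t ≡ true → host v t ≡ parent v
    host-joined joins rewrite joins = refl

    host-unjoined : ∀ {v t} → joinsParent v t ≡ false → host v t ≡ v
    host-unjoined unjoined rewrite unjoined = refl

  IsHead : V × ℕ → Set
  IsHead (o , t) = (1 ≤ t × t ≤ Λ 𝒢) × joinsParent o t ≡ false

  isHead? : ∀ h → Dec (IsHead h)
  isHead? (o , t) = ((1 ≤? t) ×-dec (t ≤? Λ 𝒢)) ×-dec (joinsParent o t ≟ᵇ false)

  host-isHead : ∀ {v t} → 1 ≤ t → t ≤ Λ 𝒢 → IsHead (host v t , t)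
  host-isHead {v} {t} 1≤t t≤Λ with joinsParent v t in joins
  ... | true rewrite host-joined joins = (1≤t , t≤Λ) , joinsParent-exclusive joins
  ... | false rewrite host-unjoined joins = (1≤t , t≤Λ) , joins

  open Enumeration isHead? (cartesianProduct (allFin (n 𝒢)) (times 𝒢))
                   (Unique.cartesianProduct⁺ (Unique.allFin⁺ (n 𝒢)) (Unique.upTo⁺ (suc (Λ 𝒢))))
    renaming (size to m; element to node; element-satisfies to node-isHead; element-injective to node-injective)

  head : Fin m → V
  head i = proj₁ (node i)

  τ : Fin m → ℕ
  τ i = proj₂ (node i)

  nodeOf : ∀ {h} → IsHead h → Fin m
  nodeOf {o , t} isHead = index (∈-cartesianProduct⁺ (∈-allFin o) (∈-upTo⁺ (s≤s (proj₂ (proj₁ isHead))))) isHead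

  node-nodeOf : ∀ {h} (isHead : IsHead h) → node (nodeOf isHead) ≡ h
  node-nodeOf {o , t} isHead = element-index _ isHead

  B : Fin m → Subset (n 𝒢)
  B i = tabulate (λ v → does (host v (τ i) ≟ᶠ head i))

  ∈B⁻ : ∀ {v i} → v ∈ₛ B i → node i ≡ (host v (τ i) , τ i)
  ∈B⁻ {v} {i} v∈ = cong (_, τ i) (sym (Equivalence.to (∈-tabulate-does (λ u → host u (τ i) ≟ᶠ head i)) v∈))

  ∈B⁺ : ∀ {v i t} → node i ≡ (host v t , t) → v ∈ₛ B i
  ∈B⁺ {v} {i} {t} node≡ = Equivalence.from (∈-tabulate-does (λ u → host u (τ i) ≟ᶠ head i)) (begin
    host v (τ i) ≡⟨ cong (host v) (cong proj₂ node≡) ⟩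
    host v t     ≡⟨ cong proj₁ node≡ ⟨
    head i       ∎)
    where open ≡-Reasoning

  head∈B : ∀ i → head i ∈ₛ B i
  head∈B i = ∈B⁺ (cong (_, τ i) (sym (host-unjoined (proj₂ (node-isHead i)))))

  cover-vertex : ∀ v t → 1 ≤ t → t ≤ Λ 𝒢 → ∃! λ i → (τ i ≡ t) × (v ∈ₛ B i)
  cover-vertex v t 1≤t t≤Λ = i , (cong proj₂ node-i , ∈B⁺ node-i) , unique
    where
    i : Fin m
    i = nodeOf (host-isHead {v} 1≤t t≤Λ)
    node-i : node i ≡ (host v t , t)
    node-i = node-nodeOf _
    unique : ∀ j → (τ j ≡ t) × (v ∈ₛ B j) → j ≡ i
    unique j (τj≡t , v∈Bj) =
      node-injective j i (trans (∈B⁻ v∈Bj) (trans (cong (λ s → host v s , s) τj≡t) (sym node-i)))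

  parentEdge-host : ∀ {u v t} → parent v ≡ u → act 𝒢 u v t ≡ true → host u t ≡ host v t
  parentEdge-host {u} {v} {t} pv≡u a = begin
    host u t ≡⟨ host-unjoined (subst (λ p → joinsParent p t ≡ false) pv≡u (joinsParent-exclusive joins)) ⟩
    u        ≡⟨ pv≡u ⟨
    parent v ≡⟨ host-joined joins ⟨
    host v t ∎
    where
    open ≡-Reasoning
    joins : joinsParent v t ≡ true
    joins = act⇒act' (subst (λ p → act 𝒢 p v t ≡ true) (sym pv≡u) a)

  edge-host : ∀ {u v t} → act 𝒢 u v t ≡ true → host u t ≡ host v t
  edge-host {t = t} a with adj⇒parent (t , a)
  ... | inj₁ pv≡u = parentEdge-host pv≡u a
  ... | inj₂ pu≡v = sym (parentEdge-host pu≡v (act-swap a))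

  cover-edge : ∀ u v t → act 𝒢 u v t ≡ true → ∃! λ i → (u ∈ₛ B i) × (v ∈ₛ B i) × (τ i ≡ t)
  cover-edge u v t a with act-range 𝒢 u v t a
  ... | 1≤t , t≤Λ with cover-vertex u t 1≤t t≤Λ
  ...   | i , (τi≡t , u∈Bi) , unique =
    i , (u∈Bi , ∈B⁺ {v} (trans (∈B⁻ u∈Bi) (cong (_, τ i) (edge-host (subst (λ s → act 𝒢 u v s ≡ true) (sym τi≡t) a)))) , τi≡t) ,
    λ j (u∈Bj , _ , τj≡t) → unique j (τj≡t , u∈Bj)

  bag-width : ∀ i → ∣ B i ∣ ≤ suc (maxDeg' 𝒢)
  bag-width i = ≤-trans (∣p∣≤1+∣q∣ (head i) others-adjacent)
                        (s≤s (deg'≤maxDeg' (head i) (proj₂ (proj₁ (node-isHead i)))))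
    where
    others-adjacent : ∀ {v} → v ∈ₛ B i → v ≢ head i → v ∈ₛ tabulate (λ u → act' 𝒢 u (head i) (τ i))
    others-adjacent {v} v∈ v≢head with joinsParent v (τ i) in joins | cong proj₁ (∈B⁻ v∈)
    ... | true | head≡host = Equivalence.from (∈-tabulate _)
          (act'-sym (subst (λ p → act' 𝒢 p v (τ i) ≡ true) (trans (sym (host-joined joins)) (sym head≡host)) joins))
    ... | false | head≡host = contradiction (trans (sym (host-unjoined joins)) (sym head≡host)) v≢head

  Settled : V → ℕ → Set
  Settled o t = o ≡ r ⊎ ActiveBy (parent o) o t

  settled? : ∀ o t → Dec (Settled o t)
  settled? o t = (o ≟ᶠ r) ⊎-dec activeBy? (parent o) o t

  settled-suc : ∀ {o t} → Settled o t → Settled o (suc t)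
  settled-suc (inj₁ o≡r) = inj₁ o≡r
  settled-suc (inj₂ (t₁ , t₁≤t , a)) = inj₂ (t₁ , m≤n⇒m≤1+n t₁≤t , a)

  settled-pred : ∀ {o t} → Settled o t → joinsParent o t ≡ false → Settled o (pred t)
  settled-pred (inj₁ o≡r) _ = inj₁ o≡r
  settled-pred (inj₂ (t₁ , t₁≤t , a)) unjoined with m≤n⇒m<n∨m≡n t₁≤t
  ... | inj₁ t₁<t = inj₂ (t₁ , pred-mono-≤ t₁<t , a)
  ... | inj₂ refl = contradiction (trans (sym (act⇒act' a)) unjoined) λ ()

  unsettled-suc : ∀ {o t} → ¬ Settled o t → joinsParent o (suc t) ≡ false → ¬ Settled o (suc t)
  unsettled-suc ¬settled unjoined (inj₁ o≡r) = ¬settled (inj₁ o≡r)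
  unsettled-suc ¬settled unjoined (inj₂ (t₁ , t₁≤1+t , a)) with m≤n⇒m<n∨m≡n t₁≤1+t
  ... | inj₁ t₁<1+t = ¬settled (inj₂ (t₁ , s≤s⁻¹ t₁<1+t , a))
  ... | inj₂ refl = contradiction (trans (sym (act⇒act' a)) unjoined) λ ()

  unsettled⇒suc≤Λ : ∀ {o t} → ¬ Settled o t → suc t ≤ Λ 𝒢
  unsettled⇒suc≤Λ {o} {t} ¬settled with parent-adj (¬settled ∘ inj₁)
  ... | t₀ , a with t₀ ≤? t
  ...   | yes t₀≤t = contradiction (inj₂ (t₀ , t₀≤t , a)) ¬settled
  ...   | no t₀≰t = ≤-trans (≰⇒> t₀≰t) (proj₂ (act-range 𝒢 _ _ _ a))

  -- The neighbour of a bag on its way to the bag of r at time 1 in T.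
  next : V × ℕ → V × ℕ
  next (o , t) with settled? o t
  ... | yes _ = host o (pred t) , pred t
  ... | no _ = host o (suc t) , suc t

  next-settled : ∀ {o t} → Settled o t → next (o , t) ≡ (host o (pred t) , pred t)
  next-settled {o} {t} settled with settled? o t
  ... | yes _ = refl
  ... | no ¬settled = contradiction settled ¬settled

  next-unsettled : ∀ {o t} → ¬ Settled o t → next (o , t) ≡ (host o (suc t) , suc t)
  next-unsettled {o} {t} ¬settled with settled? o t
  ... | yes settled = contradiction settled ¬settled
  ... | no _ = refl

  clock : V × ℕ → ℕ
  clock (o , t) with settled? o t
  ... | yes _ = t
  ... | no _ = Λ 𝒢 ∸ t

  clock-settled : ∀ {o t} → Settled o t → clock (o , t) ≡ t
  clock-settled {o} {t} settled with settled? o t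
  ... | yes _ = refl
  ... | no ¬settled = contradiction settled ¬settled

  clock-unsettled : ∀ {o t} → ¬ Settled o t → clock (o , t) ≡ Λ 𝒢 ∸ t
  clock-unsettled {o} {t} ¬settled with settled? o t
  ... | yes settled = contradiction settled ¬settled
  ... | no _ = refl

  clock≤Λ : ∀ {o t} → t ≤ Λ 𝒢 → clock (o , t) ≤ Λ 𝒢
  clock≤Λ {o} {t} t≤Λ with settled? o t
  ... | yes _ = t≤Λ
  ... | no _ = m∸n≤m (Λ 𝒢) t

  -- Lexicographic in (depth, clock); the clock counts the time steps still to travel.
  potential : V × ℕ → ℕ
  potential (o , t) = depth o * suc (Λ 𝒢) + clock (o , t)

  potential-parent : ∀ {o t t′} → o ≢ r → t′ ≤ Λ 𝒢 → potential (parent o , t′) < potential (o , t)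
  potential-parent {o} {t} {t′} o≢r t′≤Λ = begin-strict
    depth (parent o) * K + clock (parent o , t′) ≤⟨ +-monoʳ-≤ (depth (parent o) * K) (clock≤Λ {parent o} t′≤Λ) ⟩
    depth (parent o) * K + Λ 𝒢                  <⟨ +-monoʳ-< (depth (parent o) * K) (n<1+n (Λ 𝒢)) ⟩
    depth (parent o) * K + K                    ≡⟨ +-comm (depth (parent o) * K) K ⟩
    suc (depth (parent o)) * K                  ≡⟨ cong (_* K) (depth-parent o≢r) ⟩
    depth o * K                                 ≤⟨ m≤m+n (depth o * K) (clock (o , t)) ⟩
    potential (o , t)                           ∎
    where
    open ≤-Reasoning
    K : ℕ
    K = suc (Λ 𝒢)

  potential-host : ∀ {o t t′} → t′ ≤ Λ 𝒢 → (joinsParent o t′ ≡ false → clock (o , t′) < clock (o , t)) →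
                   potential (host o t′ , t′) < potential (o , t)
  potential-host {o} {t} {t′} t′≤Λ clock< with joinsParent o t′ in joins
  ... | true = subst (λ v → potential (v , t′) < potential (o , t)) (sym (host-joined joins))
                     (potential-parent (joinsParent⇒≢r joins) t′≤Λ)
  ... | false = subst (λ v → potential (v , t′) < potential (o , t)) (sym (host-unjoined joins))
                      (+-monoʳ-< (depth o * suc (Λ 𝒢)) (clock< refl))

  next-descends : ∀ {o t} → IsHead (o , t) → potential (next (o , t)) < potential (o , t)
  next-descends {o} {t} ((1≤t , t≤Λ) , unjoined) with toSum (settled? o t)
  ... | inj₁ settled =
    subst (λ h → potential h < potential (o , t)) (sym (next-settled settled))
      (potential-host (≤-trans pred[n]≤n t≤Λ) λ _ → begin-strict
        clock (o , pred t) ≡⟨ clock-settled (settled-pred settled unjoined) ⟩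
        pred t             <⟨ pred[n]<n 1≤t ⟩
        t                  ≡⟨ clock-settled settled ⟨
        clock (o , t)      ∎)
    where open ≤-Reasoning
  ... | inj₂ ¬settled =
    subst (λ h → potential h < potential (o , t)) (sym (next-unsettled ¬settled))
      (potential-host (unsettled⇒suc≤Λ ¬settled) λ unjoined′ → begin-strict
        clock (o , suc t) ≡⟨ clock-unsettled (unsettled-suc ¬settled unjoined′) ⟩
        Λ 𝒢 ∸ suc t       <⟨ ∸-monoʳ-< (n<1+n t) (unsettled⇒suc≤Λ ¬settled) ⟩
        Λ 𝒢 ∸ t           ≡⟨ clock-unsettled ¬settled ⟨
        clock (o , t)     ∎)
    where open ≤-Reasoning

  next-isHead : ∀ {o t} → IsHead (o , t) → (o , t) ≢ (r , 1) → IsHead (next (o , t))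
  next-isHead {o} {t} ((1≤t , t≤Λ) , unjoined) ≢root with toSum (settled? o t)
  ... | inj₁ settled = subst IsHead (sym (next-settled settled))
    (host-isHead (1≤pred (settled-pred settled unjoined)) (≤-trans pred[n]≤n t≤Λ))
    where
    1≤pred : Settled o (pred t) → 1 ≤ pred t
    1≤pred (inj₁ refl) = pred-mono-≤ (≤∧≢⇒< 1≤t λ 1≡t → ≢root (cong (r ,_) (sym 1≡t)))
    1≤pred (inj₂ (t₁ , t₁≤pred , a)) = ≤-trans (proj₁ (act-range 𝒢 _ _ _ a)) t₁≤pred
  ... | inj₂ ¬settled = subst IsHead (sym (next-unsettled ¬settled)) (host-isHead (s≤s z≤n) (unsettled⇒suc≤Λ ¬settled))

  stationary : ∀ {w t} → joinsParent w t ≡ false → joinsParent w (suc t) ≡ false →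
               next (w , t) ≡ (w , suc t) ⊎ next (w , suc t) ≡ (w , t)
  stationary {w} {t} unjoined unjoined′ with toSum (settled? w t)
  ... | inj₁ settled = inj₂ (trans (next-settled (settled-suc settled)) (cong (_, t) (host-unjoined unjoined)))
  ... | inj₂ ¬settled = inj₁ (trans (next-unsettled ¬settled) (cong (_, suc t) (host-unjoined unjoined′)))

  consecutive-hosts : ∀ v t → next (host v t , t) ≡ (host v (suc t) , suc t)
                           ⊎ next (host v (suc t) , suc t) ≡ (host v t , t)
  consecutive-hosts v t with joinsParent v t in joins | joinsParent v (suc t) in joins′
  ... | false | false rewrite host-unjoined joins | host-unjoined joins′ = stationary joins joins′
  ... | true | true rewrite host-joined joins | host-joined joins′ =
    stationary (joinsParent-exclusive joins) (joinsParent-exclusive joins′)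
  ... | false | true rewrite host-unjoined joins | host-joined joins′ =
    inj₁ (trans (next-unsettled ¬settled) (cong (_, suc t) (host-joined joins′)))
    where
    ¬settled : ¬ Settled v t
    ¬settled (inj₁ v≡r) = joinsParent⇒≢r joins′ v≡r
    ¬settled (inj₂ activeBy) with proj₂ (act'⇒straddle joins′)
    ... | t₂ , 1+t≤t₂ , a = contradiction (trans (sym (straddle⇒act' activeBy (t₂ , ≤-trans (n≤1+n t) 1+t≤t₂ , a))) joins) λ ()
  ... | true | false rewrite host-joined joins | host-unjoined joins′ =
    inj₂ (trans (next-settled (settled-suc (inj₂ (proj₁ (act'⇒straddle joins))))) (cong (_, t) (host-joined joins)))

  Arc : Fin m → Fin m → Set
  Arc i j = (∃[ v ] (v ∈ₛ B i × v ∈ₛ B j)) × (τ j ≡ suc (τ i))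

  ArcU : Fin m → Fin m → Set
  ArcU i j = Arc i j ⊎ Arc j i

  Step : Fin m → Fin m → Set
  Step i j = next (node i) ≡ node j

  arc⇒step : ∀ {i j} → Arc i j → Step i j ⊎ Step j i
  arc⇒step {i} {j} ((v , v∈Bi , v∈Bj) , τj≡1+τi) =
    subst₂ (λ a b → next a ≡ b ⊎ next b ≡ a) (sym (∈B⁻ v∈Bi)) (sym node-j) (consecutive-hosts v (τ i))
    where
    node-j : node j ≡ (host v (suc (τ i)) , suc (τ i))
    node-j = trans (∈B⁻ v∈Bj) (cong (λ s → host v s , s) τj≡1+τi)

  step⇒arc : ∀ {i j} → Step i j → ArcU i j
  step⇒arc {i} {j} step with toSum (settled? (head i) (τ i))
  ... | inj₁ settled = inj₂ ((head i , ∈B⁺ node-j , head∈B i) , τi≡1+τj)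
    where
    node-j : node j ≡ (host (head i) (pred (τ i)) , pred (τ i))
    node-j = trans (sym step) (next-settled settled)
    τi≡1+τj : τ i ≡ suc (τ j)
    τi≡1+τj = trans (sym (suc-pred (τ i) {{>-nonZero (proj₁ (proj₁ (node-isHead i)))}}))
                    (cong suc (sym (cong proj₂ node-j)))
  ... | inj₂ ¬settled = inj₁ ((head i , head∈B i , ∈B⁺ node-j) , cong proj₂ node-j)
    where
    node-j : node j ≡ (host (head i) (suc (τ i)) , suc (τ i))
    node-j = trans (sym step) (next-unsettled ¬settled)

  arcU⇒step : ∀ {i j} → ArcU i j → Step i j ⊎ Step j i
  arcU⇒step (inj₁ arc) = arc⇒step arc
  arcU⇒step (inj₂ arc) = Sum.swap (arc⇒step arc)

  step-functional : ∀ {i j k} → Step i j → Step i k → j ≡ k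
  step-functional {j = j} {k} step step′ = node-injective j k (trans (sym step) step′)

  step-descends : ∀ {i j} → Step i j → potential (node j) < potential (node i)
  step-descends {i} step = subst (λ h → potential h < potential (node i)) step (next-descends (node-isHead i))

  open Descent step-functional (potential ∘ node) step-descends arcU⇒step

  rootHead : 1 ≤ Λ 𝒢 → IsHead (r , 1)
  rootHead 1≤Λ = (≤-refl , 1≤Λ) , ¬-not (act'-irrefl ∘ subst (λ p → act' 𝒢 p r 1 ≡ true) parent-r)

  sink : Fin m → ∃[ ρ ] (∀ i → i ≢ ρ → ∃ (Step i))
  sink i = ρ , λ j j≢ρ → nodeOf (next-isHead (node-isHead j) (node≢root j≢ρ)) , sym (node-nodeOf _)
    where
    ρ : Fin m
    ρ = nodeOf (rootHead (≤-trans (proj₁ (proj₁ (node-isHead i))) (proj₂ (proj₁ (node-isHead i)))))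
    node≢root : ∀ {j} → j ≢ ρ → node j ≢ (r , 1)
    node≢root {j} j≢ρ node≡ = j≢ρ (node-injective j ρ (trans node≡ (sym (node-nodeOf _))))

  T-isTree : IsTree ArcU
  T-isTree = connected Sum.swap step⇒arc sink , acyclic

  decomposition : TIMDecomposition 𝒢
  decomposition = record
    { m = m
    ; B = B
    ; τ = τ
    ; τ-range = λ i → proj₁ (node-isHead i)
    ; cover-vertex = cover-vertex
    ; cover-edge = cover-edge
    ; T-tree = T-isTree
    }

mainTheorem13 : (𝒢 : TemporalGraph) →
    IsTree (UAdj 𝒢) →
    ∃[ r ] RootOrdered 𝒢 r →
    ∃[ D ] HasWidthAtMost {𝒢} D (suc (maxDeg' 𝒢))
mainTheorem13 𝒢 tree (r , root-ordered) = decomposition , bag-width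
  where open Construction 𝒢 tree r root-ordered
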